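{- Let $G=(V,E_G)$ be the rectangular grid graph with vertices $(x,y)$, $1\le x\le n$, $1\le y\le m$, adjacent iff they differ by $1$ in exactly one coordinate. Let $E=(x_E,y_E)$, $F=(x_F,y_F)\in V$ satisfy: $x_F\le x_E$, $y_E\le y_F$, $x_E-x_F\le y_F-y_E$; $x_F\ne x_E$; ${\rm Gain}'\ge 2$, where ${\rm Gain}'=\max\big(0,\big||y_F-y_E|-|x_E-x_F|\big|-1\big)$; and neither $E$ nor $F$ lies on the boundary of the grid. Let $G'=(V,E_G\cup\{EF\})$, and let $N$ be the set of vertices $Z$ such that $d_{G'}(Z,A)=d_G(Z,A)$ for every vertex $A$. With $\alpha=\frac{1+y_F+y_E+x_F-x_E}{2}$ and $\beta_0=\frac{1+y_F+y_E+x_E-x_F}{2}$, $$N=\{(x,y): x<x_F,\ \alpha-1\le y\le\alpha\}\cup\{(x,y): x_F\le x\le x_E,\ x_F-\alpha\le x-y\le x_F-\alpha+1\}\cup\{(x,y): x>x_E,\ \beta_0-1\le y\le \beta_0\}.$$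
   Context: $d_H$ denotes shortest-path distance in the graph $H$; all sets range over vertices $(x,y)$ of the grid. -}

module Defs where

open import Data.Nat using (ℕ; zero; suc; _≤_; _<_)
open import Data.Integer as ℤ using (ℤ; +_; _⊔_)
open import Data.Product using (_×_; _,_; Σ; ∃)
open import Data.Sum using (_⊎_)
open import Relation.Binary.PropositionalEquality using (_≡_)

Vtx : Set
Vtx = ℕ × ℕ

InGrid : ℕ → ℕ → Vtx → Set
InGrid n m (x , y) = (1 ≤ x × x ≤ n) × (1 ≤ y × y ≤ m)

Interior : ℕ → ℕ → Vtx → Set
Interior n m (x , y) = (1 < x × x < n) × (1 < y × y < m)

Rel : Set₁
Rel = Vtx → Vtx → Set

GridAdj : Rel
GridAdj (x₁ , y₁) (x₂ , y₂) =
  (x₁ ≡ x₂ × (y₂ ≡ suc y₁ ⊎ y₁ ≡ suc y₂)) ⊎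
  (y₁ ≡ y₂ × (x₂ ≡ suc x₁ ⊎ x₁ ≡ suc x₂))

AddEdge : Rel → Vtx → Vtx → Rel
AddEdge H E F u v = H u v ⊎ ((u ≡ E × v ≡ F) ⊎ (u ≡ F × v ≡ E))

data Walk (n m : ℕ) (H : Rel) : Vtx → Vtx → ℕ → Set where
  here : ∀ {u} → InGrid n m u → Walk n m H u u 0
  step : ∀ {u w v k} → InGrid n m u → H u w → Walk n m H w v k →
         Walk n m H u v (suc k)

Dist : (n m : ℕ) → Rel → Vtx → Vtx → ℕ → Set
Dist n m H u v d =
  Walk n m H u v d × (∀ k → Walk n m H u v k → d ≤ k)

InN : (n m : ℕ) → Vtx → Vtx → Vtx → Set
InN n m E F Z = ∀ A → InGrid n m A → ∀ d₁ d₂ →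
  Dist n m GridAdj Z A d₁ → Dist n m (AddEdge GridAdj E F) Z A d₂ → d₁ ≡ d₂

Gain′ : Vtx → Vtx → ℤ
Gain′ (xE , yE) (xF , yF) =
  + 0 ⊔ ((+ ℤ.∣ (+ ℤ.∣ + yF ℤ.- + yE ∣) ℤ.- (+ ℤ.∣ + xE ℤ.- + xF ∣) ∣) ℤ.- + 1)

-- the explicit description of N. Half-integers α, β₀ are handled by doubling:
-- 2α = 1 + y_F + y_E + x_F - x_E ,  2β₀ = 1 + y_F + y_E + x_E - x_F
twoα : Vtx → Vtx → ℤ
twoα (xE , yE) (xF , yF) = + 1 ℤ.+ + yF ℤ.+ + yE ℤ.+ + xF ℤ.- + xE

twoβ₀ : Vtx → Vtx → ℤ
twoβ₀ (xE , yE) (xF , yF) = + 1 ℤ.+ + yF ℤ.+ + yE ℤ.+ + xE ℤ.- + xF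

-- membership in the right-hand side union
--   {x < x_F, α-1 ≤ y ≤ α} ∪ {x_F ≤ x ≤ x_E, x_F-α ≤ x-y ≤ x_F-α+1}
--   ∪ {x > x_E, β₀-1 ≤ y ≤ β₀}   (all inequalities multiplied by 2)
InRHS : Vtx → Vtx → Vtx → Set
InRHS E@(xE , yE) F@(xF , yF) (x , y) =
  (x < xF × (twoα E F ℤ.- + 2 ℤ.≤ + 2 ℤ.* + y × + 2 ℤ.* + y ℤ.≤ twoα E F)) ⊎
  ((xF ≤ x × x ≤ xE) ×
     (+ 2 ℤ.* + xF ℤ.- twoα E F ℤ.≤ + 2 ℤ.* (+ x ℤ.- + y) ×
      + 2 ℤ.* (+ x ℤ.- + y) ℤ.≤ + 2 ℤ.* + xF ℤ.- twoα E F ℤ.+ + 2)) ⊎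
  (xE < x × (twoβ₀ E F ℤ.- + 2 ℤ.≤ + 2 ℤ.* + y × + 2 ℤ.* + y ℤ.≤ twoβ₀ E F))

-- The grid distance d_G is the Manhattan distance: a staircase walk attains it and no edge
-- changes it by more than one.  For the same reason the distance in G' is
--   d_G'(u , v) = min (|uv| , |uE| + 1 + |Fv| , |uF| + 1 + |Ev|),
-- a function that vanishes on the diagonal and drops by at most one along every edge of G'.
-- So Z ∈ N iff the new edge shortens no path from Z, i.e. iff |d_G(Z,E) - d_G(Z,F)| ≤ 1:
-- take A = F or A = E for one direction and use the triangle inequality for the other.  Because
-- (y_F - y_E) - (x_E - x_F) ≥ 3, this balance fails outside the band y_E ≤ y ≤ y_F, and inside
-- the band it is a pair of linear inequalities in each of the columns x < x_F,
-- x_F ≤ x ≤ x_E and x_E < x, which are the three strips of the statement.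

module Submission where

open import Defs
open import Data.Nat using (ℕ; _≤_; _∸_)
open import Data.Integer using (+_) renaming (_≤_ to _≤ℤ_)
open import Data.Product using (_×_; _,_)
open import Relation.Nullary using (¬_)
open import Relation.Binary.PropositionalEquality using (_≡_)
open import Function.Bundles using (_⇔_)

open import Relation.Binary.PropositionalEquality
  using (_≢_; refl; sym; trans; cong; cong₂; subst; subst₂)
open import Function.Bundles using (mk⇔; module Equivalence)
open import Function.Construct.Composition using (_⇔-∘_)

open Equivalence using (to; from)

module Bisector where
  open import Data.Nat using (suc)
  open import Data.Integer using (ℤ; _+_; _-_; _*_; -_; 0ℤ)
  open import Data.Integer.Properties using (+-mono-≤; i≤j⇒0≤j-i; 0≤i-j⇒j≤i)
  open import Data.Integer.Tactic.RingSolver using (solve)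
  open import Data.List using (_∷_; [])
  open import Data.Product.Function.NonDependent.Propositional using (_×-⇔_)
  open import Data.Product using (swap)

  ≤⇔≤-by-difference : ∀ {i j i′ j′ : ℤ} → j - i ≡ j′ - i′ → i ≤ℤ j ⇔ i′ ≤ℤ j′
  ≤⇔≤-by-difference eq = mk⇔ (transport eq) (transport (sym eq))
    where
    transport : ∀ {i j i′ j′} → j - i ≡ j′ - i′ → i ≤ℤ j → i′ ≤ℤ j′
    transport eq i≤j = 0≤i-j⇒j≤i (subst (0ℤ ≤ℤ_) eq (i≤j⇒0≤j-i i≤j))

  i≤j⇒j-i≢-[1+k] : ∀ {i j : ℤ} → i ≤ℤ j → ∀ k → j - i ≢ - + suc k
  i≤j⇒j-i≢-[1+k] i≤j k eq with subst (0ℤ ≤ℤ_) eq (i≤j⇒0≤j-i i≤j)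
  ... | ()

  ≤×≤⇔≤×≤-by-differences : ∀ {i j k l i′ j′ k′ l′ : ℤ} → j - i ≡ j′ - i′ → l - k ≡ l′ - k′ →
                            (i ≤ℤ j × k ≤ℤ l) ⇔ (i′ ≤ℤ j′ × k′ ≤ℤ l′)
  ≤×≤⇔≤×≤-by-differences eq₁ eq₂ = ≤⇔≤-by-difference eq₁ ×-⇔ ≤⇔≤-by-difference eq₂

  _⊕_ : ∀ {i j k l : ℤ} → i ≤ℤ j → k ≤ℤ l → i + k ≤ℤ j + l
  _⊕_ = +-mono-≤
  infixl 6 _⊕_

  Balancedℤ : ℤ → ℤ → Set
  Balancedℤ p q = (q ≤ℤ + 1 + p) × (p ≤ℤ + 1 + q)

  module Strips (xE yE xF yF : ℤ) where
    Strip₁ Strip₃ : ℤ → Set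
    Strip₁ Y = ((+ 1 + yF + yE + xF - xE) - + 2 ≤ℤ + 2 * Y) × (+ 2 * Y ≤ℤ + 1 + yF + yE + xF - xE)
    Strip₃ Y = ((+ 1 + yF + yE + xE - xF) - + 2 ≤ℤ + 2 * Y) × (+ 2 * Y ≤ℤ + 1 + yF + yE + xE - xF)

    Strip₂ : ℤ → ℤ → Set
    Strip₂ X Y = (+ 2 * xF - (+ 1 + yF + yE + xF - xE) ≤ℤ + 2 * (X - Y)) ×
                 (+ 2 * (X - Y) ≤ℤ + 2 * xF - (+ 1 + yF + yE + xF - xE) + + 2)

    strip₁⇔ : ∀ X Y → Balancedℤ ((xE - X) + (Y - yE)) ((xF - X) + (yF - Y)) ⇔ Strip₁ Y
    strip₁⇔ X Y = ≤×≤⇔≤×≤-by-differences eq₁ eq₂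
      where
      eq₁ : (+ 1 + ((xE - X) + (Y - yE))) - ((xF - X) + (yF - Y))
          ≡ + 2 * Y - ((+ 1 + yF + yE + xF - xE) - + 2)
      eq₁ = solve (X ∷ Y ∷ xE ∷ yE ∷ xF ∷ yF ∷ [])
      eq₂ : (+ 1 + ((xF - X) + (yF - Y))) - ((xE - X) + (Y - yE))
          ≡ (+ 1 + yF + yE + xF - xE) - + 2 * Y
      eq₂ = solve (X ∷ Y ∷ xE ∷ yE ∷ xF ∷ yF ∷ [])

    strip₂⇔ : ∀ X Y → Balancedℤ ((xE - X) + (Y - yE)) ((X - xF) + (yF - Y)) ⇔ Strip₂ X Y
    strip₂⇔ X Y = ≤×≤⇔≤×≤-by-differences eq₁ eq₂ ⇔-∘ mk⇔ swap swap
      where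
      eq₁ : (+ 1 + ((X - xF) + (yF - Y))) - ((xE - X) + (Y - yE))
          ≡ + 2 * (X - Y) - (+ 2 * xF - (+ 1 + yF + yE + xF - xE))
      eq₁ = solve (X ∷ Y ∷ xE ∷ yE ∷ xF ∷ yF ∷ [])
      eq₂ : (+ 1 + ((xE - X) + (Y - yE))) - ((X - xF) + (yF - Y))
          ≡ (+ 2 * xF - (+ 1 + yF + yE + xF - xE) + + 2) - + 2 * (X - Y)
      eq₂ = solve (X ∷ Y ∷ xE ∷ yE ∷ xF ∷ yF ∷ [])

    strip₃⇔ : ∀ X Y → Balancedℤ ((X - xE) + (Y - yE)) ((X - xF) + (yF - Y)) ⇔ Strip₃ Y
    strip₃⇔ X Y = ≤×≤⇔≤×≤-by-differences eq₁ eq₂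
      where
      eq₁ : (+ 1 + ((X - xE) + (Y - yE))) - ((X - xF) + (yF - Y))
          ≡ + 2 * Y - ((+ 1 + yF + yE + xE - xF) - + 2)
      eq₁ = solve (X ∷ Y ∷ xE ∷ yE ∷ xF ∷ yF ∷ [])
      eq₂ : (+ 1 + ((X - xF) + (yF - Y))) - ((X - xE) + (Y - yE))
          ≡ (+ 1 + yF + yE + xE - xF) - + 2 * Y
      eq₂ = solve (X ∷ Y ∷ xE ∷ yE ∷ xF ∷ yF ∷ [])

    module OffBand (xF<xE : + 1 + xF ≤ℤ xE) (gap : + 3 ≤ℤ (yF - yE) - (xE - xF)) where
      ¬balanced-below : ∀ Y u v → u ≤ℤ v + (xE - xF) → ¬ Balancedℤ (u + (yE - Y)) (v + (yF - Y))
      ¬balanced-below Y u v tri (q≤1+p , _) =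
        i≤j⇒j-i≢-[1+k] (q≤1+p ⊕ tri ⊕ gap) 1 (solve (xE ∷ yE ∷ xF ∷ yF ∷ Y ∷ u ∷ v ∷ []))

      ¬balanced-above : ∀ Y u v → v ≤ℤ u + (xE - xF) → ¬ Balancedℤ (u + (Y - yE)) (v + (Y - yF))
      ¬balanced-above Y u v tri (_ , p≤1+q) =
        i≤j⇒j-i≢-[1+k] (p≤1+q ⊕ tri ⊕ gap) 1 (solve (xE ∷ yE ∷ xF ∷ yF ∷ Y ∷ u ∷ v ∷ []))

      module Below (Y : ℤ) (Y<yE : + 1 + Y ≤ℤ yE) where
        ¬strip₁ : ¬ Strip₁ Y
        ¬strip₁ (s , _) =
          i≤j⇒j-i≢-[1+k] (s ⊕ gap ⊕ Y<yE ⊕ Y<yE) 3 (solve (Y ∷ xE ∷ yE ∷ xF ∷ yF ∷ []))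

        ¬strip₂ : ∀ X → xF ≤ℤ X → ¬ Strip₂ X Y
        ¬strip₂ X xF≤X (_ , s) =
          i≤j⇒j-i≢-[1+k] (s ⊕ xF≤X ⊕ xF≤X ⊕ Y<yE ⊕ Y<yE ⊕ gap) 3 (solve (X ∷ Y ∷ xE ∷ yE ∷ xF ∷ yF ∷ []))

        ¬strip₃ : ¬ Strip₃ Y
        ¬strip₃ (s , _) =
          i≤j⇒j-i≢-[1+k] (s ⊕ Y<yE ⊕ Y<yE ⊕ gap ⊕ xF<xE ⊕ xF<xE) 5 (solve (Y ∷ xE ∷ yE ∷ xF ∷ yF ∷ []))

      module Above (Y : ℤ) (yF<Y : + 1 + yF ≤ℤ Y) where
        ¬strip₁ : ¬ Strip₁ Y
        ¬strip₁ (_ , s) =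
          i≤j⇒j-i≢-[1+k] (s ⊕ yF<Y ⊕ yF<Y ⊕ xF<xE ⊕ xF<xE ⊕ gap) 5 (solve (Y ∷ xE ∷ yE ∷ xF ∷ yF ∷ []))

        ¬strip₂ : ∀ X → X ≤ℤ xE → ¬ Strip₂ X Y
        ¬strip₂ X X≤xE (s , _) =
          i≤j⇒j-i≢-[1+k] (s ⊕ X≤xE ⊕ X≤xE ⊕ yF<Y ⊕ yF<Y ⊕ gap) 3 (solve (X ∷ Y ∷ xE ∷ yE ∷ xF ∷ yF ∷ []))

        ¬strip₃ : ¬ Strip₃ Y
        ¬strip₃ (_ , s) =
          i≤j⇒j-i≢-[1+k] (s ⊕ yF<Y ⊕ yF<Y ⊕ gap) 3 (solve (Y ∷ xE ∷ yE ∷ xF ∷ yF ∷ []))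

open import Data.Nat using (suc; zero; _+_; _<_; _⊓_; ∣_-_∣; s≤s; z≤n; _<?_)
open import Data.Nat.Properties
open import Data.Product using (swap)
import Data.Product as Product
open import Data.Sum using (_⊎_; inj₁; inj₂)
import Data.Sum as Sum
open import Relation.Nullary using (yes; no)
open import Algebra.Properties.CommutativeSemigroup +-commutativeSemigroup
  using () renaming (interchange to +-interchange)

manhattan : Vtx → Vtx → ℕ
manhattan (x , y) (x′ , y′) = ∣ x - x′ ∣ + ∣ y - y′ ∣

manhattan-self : ∀ u → manhattan u u ≡ 0
manhattan-self (x , y) = cong₂ _+_ (∣n-n∣≡0 x) (∣n-n∣≡0 y)

manhattan-triangle : ∀ u w v → manhattan u v ≤ manhattan u w + manhattan w v
manhattan-triangle (x , y) (x′ , y′) (x″ , y″) =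
  subst (∣ x - x″ ∣ + ∣ y - y″ ∣ ≤_) (+-interchange ∣ x - x′ ∣ ∣ x′ - x″ ∣ ∣ y - y′ ∣ ∣ y′ - y″ ∣)
    (+-mono-≤ (∣-∣-triangle x x′ x″) (∣-∣-triangle y y′ y″))

∣n-1+n∣≡1 : ∀ n → ∣ n - suc n ∣ ≡ 1
∣n-1+n∣≡1 zero    = refl
∣n-1+n∣≡1 (suc n) = ∣n-1+n∣≡1 n

GridAdj⇒manhattan≡1 : ∀ {u w} → GridAdj u w → manhattan u w ≡ 1
GridAdj⇒manhattan≡1 {x , y}     (inj₁ (refl , inj₁ refl)) = cong₂ _+_ (∣n-n∣≡0 x) (∣n-1+n∣≡1 y)
GridAdj⇒manhattan≡1 {x , suc y} (inj₁ (refl , inj₂ refl)) =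
  cong₂ _+_ (∣n-n∣≡0 x) (trans (∣-∣-comm (suc y) y) (∣n-1+n∣≡1 y))
GridAdj⇒manhattan≡1 {x , y}     (inj₂ (refl , inj₁ refl)) = cong₂ _+_ (∣n-1+n∣≡1 x) (∣n-n∣≡0 y)
GridAdj⇒manhattan≡1 {suc x , y} (inj₂ (refl , inj₂ refl)) =
  cong₂ _+_ (trans (∣-∣-comm (suc x) x) (∣n-1+n∣≡1 x)) (∣n-n∣≡0 y)

GridAdj⇒manhattan-step : ∀ {u w} → GridAdj u w → ∀ v → manhattan u v ≤ suc (manhattan w v)
GridAdj⇒manhattan-step {u} {w} u~w v =
  subst (λ k → manhattan u v ≤ k + manhattan w v) (GridAdj⇒manhattan≡1 u~w) (manhattan-triangle u w v)

GridAdj-sym : ∀ {u w} → GridAdj u w → GridAdj w u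
GridAdj-sym = Sum.map (Product.map sym Sum.swap) (Product.map sym Sum.swap)

module _ {n m : ℕ} where

  _++_ : ∀ {H u w v k l} → Walk n m H u w k → Walk n m H w v l → Walk n m H u v (k + l)
  here _     ++ walk′ = walk′
  step g h w ++ walk′ = step g h (w ++ walk′)

  snoc : ∀ {H u v w k} → Walk n m H u v k → H v w → InGrid n m w → Walk n m H u w (suc k)
  snoc (here g)     h g′ = step g h (here g′)
  snoc (step g h w) h′ g′ = step g h (snoc w h′ g′)

  Walk-map : ∀ {H H′ : Rel} → (∀ {u w} → H u w → H′ u w) →
             ∀ {u v k} → Walk n m H u v k → Walk n m H′ u v k
  Walk-map f (here g)     = here g
  Walk-map f (step g h w) = step g (f h) (Walk-map f w)

  reverse : ∀ {H} → (∀ {u w} → H u w → H w u) → ∀ {u v k} → Walk n m H u v k → Walk n m H v u k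
  reverse H-sym (here g)     = here g
  reverse H-sym (step g h w) = snoc (reverse H-sym w) (H-sym h) g

  Walk-⊓ : ∀ {H u v k l} → Walk n m H u v k → Walk n m H u v l → Walk n m H u v (k ⊓ l)
  Walk-⊓ {H} {u} {v} {k} {l} w w′ with ⊓-sel k l
  ... | inj₁ k⊓l≡k = subst (Walk n m H u v) (sym k⊓l≡k) w
  ... | inj₂ k⊓l≡l = subst (Walk n m H u v) (sym k⊓l≡l) w′

  potential≤length : ∀ {H} (ρ : Vtx → Vtx → ℕ) → (∀ v → ρ v v ≡ 0) →
                     (∀ {u w} → H u w → ∀ v → ρ u v ≤ suc (ρ w v)) →
                     ∀ {u v k} → Walk n m H u v k → ρ u v ≤ k
  potential≤length ρ ρ-self ρ-step (here _)     = ≤-reflexive (ρ-self _)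
  potential≤length ρ ρ-self ρ-step (step _ h w) =
    ≤-trans (ρ-step h _) (s≤s (potential≤length ρ ρ-self ρ-step w))

  Dist-unique : ∀ {H u v d₁ d₂} → Dist n m H u v d₁ → Dist n m H u v d₂ → d₁ ≡ d₂
  Dist-unique (w₁ , min₁) (w₂ , min₂) = ≤-antisym (min₁ _ w₂) (min₂ _ w₁)

  walk-right : ∀ {x y} k → InGrid n m (x , y) → k + x ≤ n → Walk n m GridAdj (x , y) (k + x , y) k
  walk-right zero    g _ = here g
  walk-right (suc k) g@(_ , y-in) k+x<n =
    snoc (walk-right k g (<⇒≤ k+x<n)) (inj₂ (refl , inj₁ refl)) ((s≤s z≤n , k+x<n) , y-in)

  walk-horizontal-≤ : ∀ {x x′ y} → x ≤ x′ → InGrid n m (x , y) → InGrid n m (x′ , y) →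
                      Walk n m GridAdj (x , y) (x′ , y) ∣ x - x′ ∣
  walk-horizontal-≤ {x} {x′} {y} x≤x′ g ((_ , x′≤n) , _) =
    subst₂ (λ t k → Walk n m GridAdj (x , y) (t , y) k) (m∸n+n≡m x≤x′) (sym (m≤n⇒∣m-n∣≡n∸m x≤x′))
      (walk-right (x′ ∸ x) g (subst (_≤ n) (sym (m∸n+n≡m x≤x′)) x′≤n))

  walk-horizontal : ∀ {x x′ y} → InGrid n m (x , y) → InGrid n m (x′ , y) →
                    Walk n m GridAdj (x , y) (x′ , y) ∣ x - x′ ∣
  walk-horizontal {x} {x′} {y} g g′ with ≤-total x x′
  ... | inj₁ x≤x′ = walk-horizontal-≤ x≤x′ g g′
  ... | inj₂ x′≤x = subst (Walk n m GridAdj (x , y) (x′ , y)) (∣-∣-comm x′ x)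
                      (reverse GridAdj-sym (walk-horizontal-≤ x′≤x g′ g))

transpose : ∀ {n m u v k} → Walk n m GridAdj u v k → Walk m n GridAdj (swap u) (swap v) k
transpose (here g)     = here (swap g)
transpose (step g h w) = step (swap g) (Sum.swap h) (transpose w)

walk-vertical : ∀ {n m x y y′} → InGrid n m (x , y) → InGrid n m (x , y′) →
                Walk n m GridAdj (x , y) (x , y′) ∣ y - y′ ∣
walk-vertical g g′ = transpose (walk-horizontal (swap g) (swap g′))

grid-walk : ∀ {n m u v} → InGrid n m u → InGrid n m v → Walk n m GridAdj u v (manhattan u v)
grid-walk g@(_ , y-in) g′@(x′-in , _) =
  walk-horizontal g (x′-in , y-in) ++ walk-vertical (x′-in , y-in) g′

manhattan-dist : ∀ {n m u v} → InGrid n m u → InGrid n m v → Dist n m GridAdj u v (manhattan u v)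
manhattan-dist g g′ =
  grid-walk g g′ , λ _ → potential≤length manhattan manhattan-self GridAdj⇒manhattan-step

shortcut : Vtx → Vtx → Vtx → Vtx → ℕ
shortcut E F u v =
  manhattan u v ⊓ (suc (manhattan u E + manhattan F v) ⊓ suc (manhattan u F + manhattan E v))

shortcut-swap : ∀ E F u v → shortcut E F u v ≡ shortcut F E u v
shortcut-swap E F u v = cong (manhattan u v ⊓_) (⊓-comm _ _)

shortcut≤manhattan : ∀ E F u v → shortcut E F u v ≤ manhattan u v
shortcut≤manhattan E F u v = m⊓n≤m _ _

shortcut≤via-edge : ∀ E F u v → shortcut E F u v ≤ suc (manhattan u E + manhattan F v)
shortcut≤via-edge E F u v = ≤-trans (m⊓n≤n _ _) (m⊓n≤m _ _)

shortcut-from-E : ∀ E F v → shortcut E F E v ≤ suc (manhattan F v)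
shortcut-from-E E F v =
  subst (λ k → shortcut E F E v ≤ suc (k + manhattan F v)) (manhattan-self E) (shortcut≤via-edge E F E v)

shortcut-to-F : ∀ E F u → shortcut E F u F ≤ suc (manhattan u E)
shortcut-to-F E F u =
  subst (λ k → shortcut E F u F ≤ suc k)
    (trans (cong (λ k → manhattan u E + k) (manhattan-self F)) (+-identityʳ _))
    (shortcut≤via-edge E F u F)

shortcut-self : ∀ E F v → shortcut E F v v ≡ 0
shortcut-self E F v = n≤0⇒n≡0 (≤-trans (shortcut≤manhattan E F v v) (≤-reflexive (manhattan-self v)))

shortcut-along-edge : ∀ E F v → shortcut E F E v ≤ suc (shortcut E F F v)
shortcut-along-edge E F v = ⊓-glb (shortcut-from-E E F v) (⊓-glb via-F-twice via-E)
  where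
  via-F-twice : shortcut E F E v ≤ suc (suc (manhattan F E + manhattan F v))
  via-F-twice = ≤-trans (shortcut-from-E E F v) (m≤n⇒m≤1+n (s≤s (m≤n+m _ (manhattan F E))))
  via-E : shortcut E F E v ≤ suc (suc (manhattan F F + manhattan E v))
  via-E = ≤-trans (shortcut≤manhattan E F E v) (m≤n⇒m≤1+n (m≤n⇒m≤1+n (m≤n+m _ (manhattan F F))))

shortcut-step : ∀ {E F u w} → AddEdge GridAdj E F u w → ∀ v → shortcut E F u v ≤ suc (shortcut E F w v)
shortcut-step {E} {F} (inj₁ u~w) v =
  ⊓-mono-≤ (bound v) (⊓-mono-≤ (s≤s (+-monoˡ-≤ _ (bound E))) (s≤s (+-monoˡ-≤ _ (bound F))))
  where bound = GridAdj⇒manhattan-step u~w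
shortcut-step {E} {F} (inj₂ (inj₁ (refl , refl))) v = shortcut-along-edge E F v
shortcut-step {E} {F} (inj₂ (inj₂ (refl , refl))) v =
  subst₂ (λ s t → s ≤ suc t) (sym (shortcut-swap E F F v)) (sym (shortcut-swap E F E v))
    (shortcut-along-edge F E v)

module _ {n m : ℕ} {E F : Vtx} (gE : InGrid n m E) (gF : InGrid n m F) where

  shortcut-walk : ∀ {u v} → InGrid n m u → InGrid n m v →
                  Walk n m (AddEdge GridAdj E F) u v (shortcut E F u v)
  shortcut-walk gu gv =
    Walk-⊓ (grid gu gv)
      (Walk-⊓ (snoc (grid gu gE) (inj₂ (inj₁ (refl , refl))) gF ++ grid gF gv)
              (snoc (grid gu gF) (inj₂ (inj₂ (refl , refl))) gE ++ grid gE gv))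
    where
    grid : ∀ {u v} → InGrid n m u → InGrid n m v → Walk n m (AddEdge GridAdj E F) u v (manhattan u v)
    grid gu gv = Walk-map inj₁ (grid-walk gu gv)

  shortcut-dist : ∀ {u v} → InGrid n m u → InGrid n m v →
                  Dist n m (AddEdge GridAdj E F) u v (shortcut E F u v)
  shortcut-dist gu gv =
    shortcut-walk gu gv , λ _ → potential≤length (shortcut E F) (shortcut-self E F) shortcut-step

Balanced : Vtx → Vtx → Vtx → Set
Balanced E F Z = manhattan Z F ≤ suc (manhattan Z E) × manhattan Z E ≤ suc (manhattan Z F)

module _ {n m : ℕ} {E F Z : Vtx} (gE : InGrid n m E) (gF : InGrid n m F) (gZ : InGrid n m Z) where

  shortcut≡manhattan : Balanced E F Z → ∀ A → shortcut E F Z A ≡ manhattan Z A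
  shortcut≡manhattan (ZF≤1+ZE , ZE≤1+ZF) A =
    m≤n⇒m⊓n≡m (⊓-glb (≤-trans (manhattan-triangle Z F A) (+-monoˡ-≤ _ ZF≤1+ZE))
                     (≤-trans (manhattan-triangle Z E A) (+-monoˡ-≤ _ ZE≤1+ZF)))

  InN⇔balanced : InN n m E F Z ⇔ Balanced E F Z
  InN⇔balanced = mk⇔ necessary sufficient
    where
    manhattan≡shortcut : InN n m E F Z → ∀ {A} → InGrid n m A → manhattan Z A ≡ shortcut E F Z A
    manhattan≡shortcut inN gA = inN _ gA _ _ (manhattan-dist gZ gA) (shortcut-dist gE gF gZ gA)

    necessary : InN n m E F Z → Balanced E F Z
    necessary inN =
      ≤-trans (≤-reflexive (manhattan≡shortcut inN gF)) (shortcut-to-F E F Z) ,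
      ≤-trans (≤-reflexive (trans (manhattan≡shortcut inN gE) (shortcut-swap E F Z E)))
              (shortcut-to-F F E Z)

    sufficient : Balanced E F Z → InN n m E F Z
    sufficient bal A gA d₁ d₂ dist₁ dist₂ =
      trans (Dist-unique dist₁ (manhattan-dist gZ gA))
        (trans (sym (shortcut≡manhattan bal A)) (Dist-unique (shortcut-dist gE gF gZ gA) dist₂))

import Data.Integer as ℤ
import Data.Integer.Properties as ℤ
open import Data.Integer using (+≤+; drop‿+≤+)
open Bisector using (Balancedℤ; module Strips)

+m-+n≡+[m∸n] : ∀ {m n} → n ≤ m → + m ℤ.- + n ≡ + (m ∸ n)
+m-+n≡+[m∸n] {m} {n} n≤m = trans (ℤ.m-n≡m⊖n m n) (ℤ.⊖-≥ n≤m)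

+∣m-n∣≡+n-+m : ∀ {m n} → m ≤ n → + ∣ m - n ∣ ≡ + n ℤ.- + m
+∣m-n∣≡+n-+m m≤n = trans (cong +_ (m≤n⇒∣m-n∣≡n∸m m≤n)) (sym (+m-+n≡+[m∸n] m≤n))

+∣m-n∣≡+m-+n : ∀ {m n} → n ≤ m → + ∣ m - n ∣ ≡ + m ℤ.- + n
+∣m-n∣≡+m-+n {m} {n} n≤m = trans (cong +_ (∣-∣-comm m n)) (+∣m-n∣≡+n-+m n≤m)

interval-trichotomy : ∀ x p q → x < p ⊎ (p ≤ x × x ≤ q) ⊎ q < x
interval-trichotomy x p q with x <? p | q <? x
... | yes x<p | _       = inj₁ x<p
... | no x≮p  | yes q<x = inj₂ (inj₂ q<x)
... | no x≮p  | no q≮x  = inj₂ (inj₁ (≮⇒≥ x≮p , ≮⇒≥ q≮x))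

module _ {xE yE xF yF : ℕ} (xF<xE : xF < xE) (yE≤yF : yE ≤ yF)
         (gap : + 3 ≤ℤ (+ yF ℤ.- + yE) ℤ.- (+ xE ℤ.- + xF)) where
  open Strips (+ xE) (+ yE) (+ xF) (+ yF)
  open OffBand (+≤+ xF<xE) gap

  E F : Vtx
  E = (xE , yE)
  F = (xF , yF)

  balanced⇔balancedℤ : ∀ x y {p q r s} →
                       + ∣ x - xE ∣ ≡ p → + ∣ y - yE ∣ ≡ q → + ∣ x - xF ∣ ≡ r → + ∣ y - yF ∣ ≡ s →
                       Balanced E F (x , y) ⇔ Balancedℤ (p ℤ.+ q) (r ℤ.+ s)
  balanced⇔balancedℤ x y refl refl refl refl =
    mk⇔ (Product.map +≤+ +≤+) (Product.map drop‿+≤+ drop‿+≤+)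

  balanced⇒band : ∀ x y → Balanced E F (x , y) → yE ≤ y × y ≤ yF
  balanced⇒band x y bal = ≮⇒≥ below , ≮⇒≥ above
    where
    below : ¬ y < yE
    below y<yE = ¬balanced-below (+ y) (+ ∣ x - xE ∣) (+ ∣ x - xF ∣)
      (subst (λ k → + ∣ x - xE ∣ ≤ℤ + ∣ x - xF ∣ ℤ.+ k) (+∣m-n∣≡+n-+m (<⇒≤ xF<xE))
             (+≤+ (∣-∣-triangle x xF xE)))
      (to (balanced⇔balancedℤ x y refl (+∣m-n∣≡+n-+m (<⇒≤ y<yE))
                                  refl (+∣m-n∣≡+n-+m (≤-trans (<⇒≤ y<yE) yE≤yF))) bal)
    above : ¬ yF < y
    above yF<y = ¬balanced-above (+ y) (+ ∣ x - xE ∣) (+ ∣ x - xF ∣)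
      (subst (λ k → + ∣ x - xF ∣ ≤ℤ + ∣ x - xE ∣ ℤ.+ k) (+∣m-n∣≡+m-+n (<⇒≤ xF<xE))
             (+≤+ (∣-∣-triangle x xE xF)))
      (to (balanced⇔balancedℤ x y refl (+∣m-n∣≡+m-+n (≤-trans yE≤yF (<⇒≤ yF<y)))
                                  refl (+∣m-n∣≡+m-+n (<⇒≤ yF<y))) bal)

  module _ (x y : ℕ) (yE≤y : yE ≤ y) (y≤yF : y ≤ yF) where
    balanced⇔strip₁ : x < xF → Balanced E F (x , y) ⇔ Strip₁ (+ y)
    balanced⇔strip₁ x<xF =
      strip₁⇔ (+ x) (+ y)
        ⇔-∘ balanced⇔balancedℤ x y (+∣m-n∣≡+n-+m (<⇒≤ (<-trans x<xF xF<xE))) (+∣m-n∣≡+m-+n yE≤y)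
                                   (+∣m-n∣≡+n-+m (<⇒≤ x<xF)) (+∣m-n∣≡+n-+m y≤yF)

    balanced⇔strip₂ : xF ≤ x → x ≤ xE → Balanced E F (x , y) ⇔ Strip₂ (+ x) (+ y)
    balanced⇔strip₂ xF≤x x≤xE =
      strip₂⇔ (+ x) (+ y)
        ⇔-∘ balanced⇔balancedℤ x y (+∣m-n∣≡+n-+m x≤xE) (+∣m-n∣≡+m-+n yE≤y)
                                   (+∣m-n∣≡+m-+n xF≤x) (+∣m-n∣≡+n-+m y≤yF)

    balanced⇔strip₃ : xE < x → Balanced E F (x , y) ⇔ Strip₃ (+ y)
    balanced⇔strip₃ xE<x =
      strip₃⇔ (+ x) (+ y)
        ⇔-∘ balanced⇔balancedℤ x y (+∣m-n∣≡+m-+n (<⇒≤ xE<x)) (+∣m-n∣≡+m-+n yE≤y)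
                                   (+∣m-n∣≡+m-+n (<⇒≤ (<-trans xF<xE xE<x))) (+∣m-n∣≡+n-+m y≤yF)

  strip₁⇒band : ∀ y → Strip₁ (+ y) → yE ≤ y × y ≤ yF
  strip₁⇒band y s =
    ≮⇒≥ (λ y<yE → Below.¬strip₁ (+ y) (+≤+ y<yE) s) , ≮⇒≥ (λ yF<y → Above.¬strip₁ (+ y) (+≤+ yF<y) s)

  strip₂⇒band : ∀ x y → xF ≤ x → x ≤ xE → Strip₂ (+ x) (+ y) → yE ≤ y × y ≤ yF
  strip₂⇒band x y xF≤x x≤xE s =
    ≮⇒≥ (λ y<yE → Below.¬strip₂ (+ y) (+≤+ y<yE) (+ x) (+≤+ xF≤x) s) ,
    ≮⇒≥ (λ yF<y → Above.¬strip₂ (+ y) (+≤+ yF<y) (+ x) (+≤+ x≤xE) s)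

  strip₃⇒band : ∀ y → Strip₃ (+ y) → yE ≤ y × y ≤ yF
  strip₃⇒band y s =
    ≮⇒≥ (λ y<yE → Below.¬strip₃ (+ y) (+≤+ y<yE) s) , ≮⇒≥ (λ yF<y → Above.¬strip₃ (+ y) (+≤+ yF<y) s)

  balanced⇔InRHS : ∀ Z → Balanced E F Z ⇔ InRHS E F Z
  balanced⇔InRHS (x , y) = mk⇔ balanced⇒InRHS InRHS⇒balanced
    where
    balanced⇒InRHS : Balanced E F (x , y) → InRHS E F (x , y)
    balanced⇒InRHS bal with balanced⇒band x y bal | interval-trichotomy x xF xE
    ... | yE≤y , y≤yF | inj₁ x<xF =
      inj₁ (x<xF , to (balanced⇔strip₁ x y yE≤y y≤yF x<xF) bal)
    ... | yE≤y , y≤yF | inj₂ (inj₁ (xF≤x , x≤xE)) =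
      inj₂ (inj₁ ((xF≤x , x≤xE) , to (balanced⇔strip₂ x y yE≤y y≤yF xF≤x x≤xE) bal))
    ... | yE≤y , y≤yF | inj₂ (inj₂ xE<x) =
      inj₂ (inj₂ (xE<x , to (balanced⇔strip₃ x y yE≤y y≤yF xE<x) bal))

    InRHS⇒balanced : InRHS E F (x , y) → Balanced E F (x , y)
    InRHS⇒balanced (inj₁ (x<xF , s)) =
      let yE≤y , y≤yF = strip₁⇒band y s in from (balanced⇔strip₁ x y yE≤y y≤yF x<xF) s
    InRHS⇒balanced (inj₂ (inj₁ ((xF≤x , x≤xE) , s))) =
      let yE≤y , y≤yF = strip₂⇒band x y xF≤x x≤xE s in from (balanced⇔strip₂ x y yE≤y y≤yF xF≤x x≤xE) s
    InRHS⇒balanced (inj₂ (inj₂ (xE<x , s))) =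
      let yE≤y , y≤yF = strip₃⇒band y s in from (balanced⇔strip₃ x y yE≤y y≤yF xE<x) s

2≤0⊔k-1⇒3≤k : ∀ k → + 2 ≤ℤ + 0 ℤ.⊔ (+ k ℤ.- + 1) → 3 ≤ k
2≤0⊔k-1⇒3≤k 0 (+≤+ ())
2≤0⊔k-1⇒3≤k 1 (+≤+ ())
2≤0⊔k-1⇒3≤k 2 (+≤+ (s≤s ()))
2≤0⊔k-1⇒3≤k (suc (suc (suc k))) _ = s≤s (s≤s (s≤s z≤n))

gain′⇒gap : ∀ {xE yE xF yF} → yE ≤ yF → xF ≤ xE → xE ∸ xF ≤ yF ∸ yE →
            + 2 ≤ℤ Gain′ (xE , yE) (xF , yF) → + 3 ≤ℤ (+ yF ℤ.- + yE) ℤ.- (+ xE ℤ.- + xF)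
gain′⇒gap yE≤yF xF≤xE slope gain
  rewrite +m-+n≡+[m∸n] yE≤yF | +m-+n≡+[m∸n] xF≤xE | +m-+n≡+[m∸n] slope = +≤+ (2≤0⊔k-1⇒3≤k _ gain)

claim14 : (n m xE yE xF yF : ℕ) →
    InGrid n m (xE , yE) → InGrid n m (xF , yF) →
    xF ≤ xE → yE ≤ yF → xE ∸ xF ≤ yF ∸ yE →
    ¬ (xF ≡ xE) →
    + 2 ≤ℤ Gain′ (xE , yE) (xF , yF) →
    Interior n m (xE , yE) → Interior n m (xF , yF) →
    (Z : Vtx) → InGrid n m Z →
    (InN n m (xE , yE) (xF , yF) Z ⇔ InRHS (xE , yE) (xF , yF) Z)
claim14 n m xE yE xF yF gE gF xF≤xE yE≤yF slope xF≢xE gain _ _ Z gZ =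
  balanced⇔InRHS (≤∧≢⇒< xF≤xE xF≢xE) yE≤yF (gain′⇒gap yE≤yF xF≤xE slope gain) Z
    ⇔-∘ InN⇔balanced gE gF gZ
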